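{- Let $m,n,p\in\mathbb{N}_0$ and $\lambda\in\mathbb{C}$. Then \[ \sum_{k=0}^{m}\binom{m}{k}y_{6}(k,n;\lambda,p)B_{m-k}=\frac{1}{n!}\sum_{j=0}^{n}\binom{n}{j}^{p}\lambda^{j}B_{m}(j). \]
   Context: For $k,n,p\in\mathbb{N}_0$ and $\lambda\in\mathbb{C}$, $y_6(k,n;\lambda,p)=\frac{1}{n!}\sum_{j=0}^{n}\binom{n}{j}^{p}j^{k}\lambda^{j}$ (with $0^0=1$). Bernoulli polynomials $B_m(x)$ are defined by $\frac{te^{xt}}{e^t-1}=\sum_{m\ge0}B_m(x)\frac{t^m}{m!}$, and $B_m=B_m(0)$. (In the paper both sides arise as the Volkenborn $p$-adic integral $\int_{\mathbb{Z}_p}P(x;m,n;\lambda,p)\,d\mu_1(x)$, where $P(x;m,n;\lambda,p)=\sum_{k=0}^{m}\binom{m}{k}x^{m-k}y_6(k,n;\lambda,p)$.) -}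

module Defs where

open import Data.Nat as ℕ using (ℕ; zero; suc; _≤ᵇ_; _!; _∸_)
open import Data.Nat.Properties using (_!≢0)
open import Data.Nat.Combinatorics using (_C_)
open import Data.Integer using (ℤ; +_)
open import Data.Rational as ℚ using (ℚ; _/_)
open import Data.Bool using (if_then_else_)
open import Algebra.Bundles using (CommutativeRing)

sumℚ : ℕ → (ℕ → ℚ) → ℚ
sumℚ zero    f = f 0
sumℚ (suc n) f = sumℚ n f ℚ.+ f (suc n)

sumℚ< : ℕ → (ℕ → ℚ) → ℚ
sumℚ< zero    f = ℚ.0ℚ
sumℚ< (suc n) f = sumℚ< n f ℚ.+ f n

ℕtoℚ : ℕ → ℚ
ℕtoℚ n = (+ n) / 1

powℚ : ℚ → ℕ → ℚ
powℚ x zero    = ℚ.1ℚ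
powℚ x (suc k) = x ℚ.* powℚ x k

-- Bernoulli numbers B_m = B_m(0), from  t/(e^t - 1) = Σ B_m t^m/m!.
-- Comparing coefficients of t^m in (Σ_k B_k t^k/k!)·((e^t - 1)/t) = 1:
--   B_0 = 1  and  Σ_{k=0}^{m} C(m+1,k) B_k = 0  for m ≥ 1, i.e.
--   B_m = -(1/(m+1)) Σ_{k<m} C(m+1,k) B_k.
-- bernTable m k = B_k for every k ≤ m.
bernTable : ℕ → ℕ → ℚ
bernTable zero    k = ℚ.1ℚ
bernTable (suc m) k =
  if k ≤ᵇ m then bernTable m k
  else ℚ.- (((+ 1) / suc (suc m)) ℚ.*
            sumℚ< (suc m) (λ i → ℕtoℚ (suc (suc m) C i) ℚ.* bernTable m i))

bernoulli : ℕ → ℚ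
bernoulli m = bernTable m m

-- Bernoulli polynomials, from  t e^{xt}/(e^t - 1) = (Σ B_k t^k/k!)·e^{xt}:
--   B_m(x) = Σ_{k=0}^{m} C(m,k) B_k x^{m-k}.
bernoulliPoly : ℕ → ℚ → ℚ
bernoulliPoly m x = sumℚ m (λ k → ℕtoℚ (m C k) ℚ.* (bernoulli k ℚ.* powℚ x (m ∸ k)))

invFact : ℕ → ℚ
invFact n = ((+ 1) / (n !)) {{n !≢0}}

-- Objects over a commutative ring R equipped with a map ι : ℚ → R
-- (in the theorem ι is required to be a ring homomorphism, i.e. R is a
-- ℚ-algebra; R = ℂ is the case of the paper).

module _ {c ℓ} (R : CommutativeRing c ℓ) (ι : ℚ → CommutativeRing.Carrier R) where
  open CommutativeRing R

  powR : Carrier → ℕ → Carrier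
  powR x zero    = 1#
  powR x (suc k) = x * powR x k

  sumR : ℕ → (ℕ → Carrier) → Carrier
  sumR zero    f = f 0
  sumR (suc n) f = sumR n f + f (suc n)

  -- y_6(k,n;λ,p) = (1/n!) Σ_{j=0}^{n} C(n,j)^p j^k λ^j   (0^0 = 1 via ℕ._^_)
  y6 : ℕ → ℕ → Carrier → ℕ → Carrier
  y6 k n lam p =
    ι (invFact n) * sumR n (λ j → ι (ℕtoℚ ((n C j) ℕ.^ p ℕ.* j ℕ.^ k)) * powR lam j)

  thm10LHS : ℕ → ℕ → Carrier → ℕ → Carrier
  thm10LHS m n lam p =
    sumR m (λ k → ι (ℕtoℚ (m C k)) * y6 k n lam p * ι (bernoulli (m ∸ k)))

  thm10RHS : ℕ → ℕ → Carrier → ℕ → Carrier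
  thm10RHS m n lam p =
    ι (invFact n) * sumR n (λ j → ι (ℕtoℚ ((n C j) ℕ.^ p)) * powR lam j * ι (bernoulliPoly m (ℕtoℚ j)))

module Submission where

-- Both sides are the same double sum
--     (1/n!) Σ_{j≤n} Σ_{k≤m} (C(n,j)^p λ^j) · (j^k · C(m,k) B_{m-k}).
-- For the left side, unfold y₆, pull the constants C(m,k), 1/n!, B_{m-k} through
-- the inner sum and exchange the two finite sums.  For the right side, expand
-- B_m(j) = Σ_k C(m,k) B_k j^{m-k} and reverse the summation index (k ↦ m-k, using
-- C(m,m-k) = C(m,k)), which gives B_m(j) = Σ_k j^k C(m,k) B_{m-k}.

open import Defs
open import Data.Nat using (ℕ)
open import Data.Rational using (ℚ)
open import Data.Rational.Properties using (+-*-rawRing)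
open import Algebra.Bundles using (CommutativeRing)
open import Algebra.Morphism.Structures using (IsRingHomomorphism)

open import Data.Nat as ℕ using (zero; suc; _∸_; _≤_; z≤n)
open import Data.Nat.Properties using (m≤n⇒m≤1+n; ≤-refl; m∸[m∸n]≡n)
open import Data.Nat.Combinatorics using (_C_; nCk≡nC[n∸k])
open import Data.Nat.Coprimality using (Coprime)
open import Data.Nat.Divisibility using (∣1⇒≡1)
open import Data.Integer as ℤ using (+_)
open import Data.Integer.Properties using (pos-*)
open import Data.Rational as ℚ using (mkℚ; _/_)
open import Data.Rational.Properties using (normalize-coprime)
open import Data.Product using (_,_)
import Algebra.Properties.CommutativeSemigroup as CommSemigroupProperties
import Relation.Binary.PropositionalEquality as ≡
open ≡ using (_≡_)

-- The embedding ℕ → ℚ, n ↦ n/1, preserves products and powers.  An integer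
-- over 1 is already in lowest terms, so n/1 is the literal fraction mkℚ n 1.

coprime-1 : ∀ a → Coprime a 1
coprime-1 a (_ , d∣1) = ∣1⇒≡1 d∣1

ℕtoℚ-literal : ∀ a → ℕtoℚ a ≡ mkℚ (+ a) 0 (coprime-1 a)
ℕtoℚ-literal a = normalize-coprime (coprime-1 a)

ℕtoℚ-* : ∀ a b → ℕtoℚ (a ℕ.* b) ≡ ℕtoℚ a ℚ.* ℕtoℚ b
ℕtoℚ-* a b = begin
  ℕtoℚ (a ℕ.* b)                                        ≡⟨ ≡.cong (_/ 1) (pos-* a b) ⟩
  (+ a ℤ.* + b) / 1                                     ≡⟨⟩
  mkℚ (+ a) 0 (coprime-1 a) ℚ.* mkℚ (+ b) 0 (coprime-1 b) ≡⟨ ≡.sym (≡.cong₂ ℚ._*_ (ℕtoℚ-literal a) (ℕtoℚ-literal b)) ⟩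
  ℕtoℚ a ℚ.* ℕtoℚ b                                     ∎
  where open ≡.≡-Reasoning

ℕtoℚ-^ : ∀ j k → ℕtoℚ (j ℕ.^ k) ≡ powℚ (ℕtoℚ j) k
ℕtoℚ-^ j zero    = ≡.refl
ℕtoℚ-^ j (suc k) = ≡.trans (ℕtoℚ-* j (j ℕ.^ k)) (≡.cong (ℕtoℚ j ℚ.*_) (ℕtoℚ-^ j k))

-- Finite sums Σ_{i=0}^{n} in a commutative ring.

module FiniteSums {c ℓ} (R : CommutativeRing c ℓ) (ι : ℚ → CommutativeRing.Carrier R) where
  open CommutativeRing R hiding (zero)
  open CommSemigroupProperties +-commutativeSemigroup using (interchange)
  open import Relation.Binary.Reasoning.Setoid setoid

  Σ : ℕ → (ℕ → Carrier) → Carrier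
  Σ = sumR R ι

  sum-cong : ∀ n {f g : ℕ → Carrier} → (∀ i → i ≤ n → f i ≈ g i) → Σ n f ≈ Σ n g
  sum-cong zero    f≈g = f≈g 0 z≤n
  sum-cong (suc n) f≈g =
    +-cong (sum-cong n (λ i i≤n → f≈g i (m≤n⇒m≤1+n i≤n))) (f≈g (suc n) ≤-refl)

  sum-*ˡ : ∀ n a f → a * Σ n f ≈ Σ n (λ i → a * f i)
  sum-*ˡ zero    a f = refl
  sum-*ˡ (suc n) a f = trans (distribˡ a (Σ n f) (f (suc n))) (+-cong (sum-*ˡ n a f) refl)

  sum-*ʳ : ∀ n a f → Σ n f * a ≈ Σ n (λ i → f i * a)
  sum-*ʳ zero    a f = refl
  sum-*ʳ (suc n) a f = trans (distribʳ a (Σ n f) (f (suc n))) (+-cong (sum-*ʳ n a f) refl)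

  sum-+ : ∀ n f g → Σ n (λ i → f i + g i) ≈ Σ n f + Σ n g
  sum-+ zero    f g = refl
  sum-+ (suc n) f g =
    trans (+-cong (sum-+ n f g) refl) (interchange (Σ n f) (Σ n g) (f (suc n)) (g (suc n)))

  sum-swap : ∀ m n (T : ℕ → ℕ → Carrier) →
             Σ m (λ k → Σ n (λ j → T j k)) ≈ Σ n (λ j → Σ m (λ k → T j k))
  sum-swap zero    n T = refl
  sum-swap (suc m) n T =
    trans (+-cong (sum-swap m n T) refl) (sym (sum-+ n (λ j → Σ m (T j)) (λ j → T j (suc m))))

  sum-split-first : ∀ n f → Σ (suc n) f ≈ f 0 + Σ n (λ i → f (suc i))
  sum-split-first zero    f = refl
  sum-split-first (suc n) f = trans (+-cong (sum-split-first n f) refl) (+-assoc _ _ _)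

  sum-reverse : ∀ n f → Σ n f ≈ Σ n (λ k → f (n ∸ k))
  sum-reverse zero    f = refl
  sum-reverse (suc n) f = begin
    Σ n f + f (suc n)                  ≈⟨ +-cong (sum-reverse n f) refl ⟩
    Σ n (λ k → f (n ∸ k)) + f (suc n)  ≈⟨ +-comm _ _ ⟩
    f (suc n) + Σ n (λ k → f (n ∸ k))  ≈⟨ sum-split-first n (λ k → f (suc n ∸ k)) ⟨
    Σ (suc n) (λ k → f (suc n ∸ k))    ∎

module Theorem10 {c ℓ} (R : CommutativeRing c ℓ) (ι : ℚ → CommutativeRing.Carrier R)
                 (ι-hom : IsRingHomomorphism +-*-rawRing (CommutativeRing.rawRing R) ι) where
  open CommutativeRing R hiding (zero)
  open IsRingHomomorphism ι-hom using (+-homo; *-homo; 1#-homo)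
  open CommSemigroupProperties *-commutativeSemigroup using (x∙yz≈y∙zx; x∙yz≈z∙xy; xy∙z≈xz∙y)
  open import Relation.Binary.Reasoning.Setoid setoid
  open FiniteSums R ι

  _^_ : Carrier → ℕ → Carrier
  _^_ = powR R ι

  ιℕ : ℕ → Carrier
  ιℕ a = ι (ℕtoℚ a)

  ι-sum : ∀ n f → ι (sumℚ n f) ≈ Σ n (λ i → ι (f i))
  ι-sum zero    f = refl
  ι-sum (suc n) f = trans (+-homo (sumℚ n f) (f (suc n))) (+-cong (ι-sum n f) refl)

  ι-pow : ∀ q k → ι (powℚ q k) ≈ ι q ^ k
  ι-pow q zero    = 1#-homo
  ι-pow q (suc k) = trans (*-homo q (powℚ q k)) (*-cong refl (ι-pow q k))

  ι-monomial : ∀ a j k → ι (ℕtoℚ (a ℕ.* j ℕ.^ k)) ≈ ιℕ a * ιℕ j ^ k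
  ι-monomial a j k = begin
    ι (ℕtoℚ (a ℕ.* j ℕ.^ k))        ≡⟨ ≡.cong ι (ℕtoℚ-* a (j ℕ.^ k)) ⟩
    ι (ℕtoℚ a ℚ.* ℕtoℚ (j ℕ.^ k))   ≈⟨ *-homo _ _ ⟩
    ιℕ a * ι (ℕtoℚ (j ℕ.^ k))       ≡⟨ ≡.cong (λ q → ιℕ a * ι q) (ℕtoℚ-^ j k) ⟩
    ιℕ a * ι (powℚ (ℕtoℚ j) k)      ≈⟨ *-cong refl (ι-pow _ k) ⟩
    ιℕ a * ιℕ j ^ k                 ∎

  -- The coefficient C(m,k)·B_{m-k} of x^k in the Bernoulli polynomial B_m(x).
  bernoulliCoeff : ℕ → ℕ → Carrier
  bernoulliCoeff m k = ιℕ (m C k) * ι (bernoulli (m ∸ k))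

  -- B_m(x) = Σ_{k≤m} x^k · C(m,k) B_{m-k}: the defining sum Σ_k C(m,k) B_k x^{m-k}
  -- read backwards, using C(m,m-k) = C(m,k) and m-(m-k) = k.
  bernoulliPoly-ascending : ∀ m x → ι (bernoulliPoly m x) ≈ Σ m (λ k → ι x ^ k * bernoulliCoeff m k)
  bernoulliPoly-ascending m x = begin
    ι (bernoulliPoly m x)
      ≈⟨ ι-sum m _ ⟩
    Σ m (λ k → ι (ℕtoℚ (m C k) ℚ.* (bernoulli k ℚ.* powℚ x (m ∸ k))))
      ≈⟨ sum-cong m (λ k _ → ι-term k) ⟩
    Σ m (λ k → ιℕ (m C k) * (ι (bernoulli k) * ι x ^ (m ∸ k)))
      ≈⟨ sum-reverse m _ ⟩
    Σ m (λ k → ιℕ (m C (m ∸ k)) * (ι (bernoulli (m ∸ k)) * ι x ^ (m ∸ (m ∸ k))))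
      ≈⟨ sum-cong m (λ k k≤m → reflexive (reindex k k≤m)) ⟩
    Σ m (λ k → ιℕ (m C k) * (ι (bernoulli (m ∸ k)) * ι x ^ k))
      ≈⟨ sum-cong m (λ k _ → x∙yz≈z∙xy _ _ _) ⟩
    Σ m (λ k → ι x ^ k * bernoulliCoeff m k)
      ∎
    where
    ι-term : ∀ k → ι (ℕtoℚ (m C k) ℚ.* (bernoulli k ℚ.* powℚ x (m ∸ k)))
                   ≈ ιℕ (m C k) * (ι (bernoulli k) * ι x ^ (m ∸ k))
    ι-term k = trans (*-homo _ _) (*-cong refl (trans (*-homo _ _) (*-cong refl (ι-pow x (m ∸ k)))))

    reindex : ∀ k → k ≤ m → ιℕ (m C (m ∸ k)) * (ι (bernoulli (m ∸ k)) * ι x ^ (m ∸ (m ∸ k)))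
                          ≡ ιℕ (m C k) * (ι (bernoulli (m ∸ k)) * ι x ^ k)
    reindex k k≤m = ≡.cong₂ (λ u v → ιℕ u * (ι (bernoulli (m ∸ k)) * ι x ^ v))
                            (≡.sym (nCk≡nC[n∸k] k≤m)) (m∸[m∸n]≡n k≤m)

  module _ (m n p : ℕ) (lam : Carrier) where

    weight : ℕ → Carrier
    weight j = ιℕ ((n C j) ℕ.^ p) * lam ^ j

    doubleSum : Carrier
    doubleSum = ι (invFact n) * Σ n (λ j → Σ m (λ k → weight j * (ιℕ j ^ k * bernoulliCoeff m k)))

    lhs≈doubleSum : thm10LHS R ι m n lam p ≈ doubleSum
    lhs≈doubleSum = begin
      thm10LHS R ι m n lam p
        ≈⟨ sum-cong m (λ k _ → kth-term k) ⟩
      Σ m (λ k → ι (invFact n) * Σ n (λ j → T j k))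
        ≈⟨ sum-*ˡ m _ _ ⟨
      ι (invFact n) * Σ m (λ k → Σ n (λ j → T j k))
        ≈⟨ *-cong refl (sum-swap m n T) ⟩
      doubleSum
        ∎
      where
      T : ℕ → ℕ → Carrier
      T j k = weight j * (ιℕ j ^ k * bernoulliCoeff m k)

      summand : ∀ k j → ι (ℕtoℚ ((n C j) ℕ.^ p ℕ.* j ℕ.^ k)) * lam ^ j * bernoulliCoeff m k ≈ T j k
      summand k j = begin
        ι (ℕtoℚ ((n C j) ℕ.^ p ℕ.* j ℕ.^ k)) * lam ^ j * bernoulliCoeff m k
          ≈⟨ *-cong (*-cong (ι-monomial ((n C j) ℕ.^ p) j k) refl) refl ⟩
        ιℕ ((n C j) ℕ.^ p) * ιℕ j ^ k * lam ^ j * bernoulliCoeff m k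
          ≈⟨ *-cong (xy∙z≈xz∙y _ _ _) refl ⟩
        weight j * ιℕ j ^ k * bernoulliCoeff m k
          ≈⟨ *-assoc _ _ _ ⟩
        T j k
          ∎

      kth-term : ∀ k → ιℕ (m C k) * y6 R ι k n lam p * ι (bernoulli (m ∸ k))
                       ≈ ι (invFact n) * Σ n (λ j → T j k)
      kth-term k = begin
        ιℕ (m C k) * (ι (invFact n) * Σ n _) * ι (bernoulli (m ∸ k))
          ≈⟨ trans (*-cong (x∙yz≈y∙zx _ _ _) refl) (trans (*-assoc _ _ _) (*-cong refl (*-assoc _ _ _))) ⟩
        ι (invFact n) * (Σ n _ * bernoulliCoeff m k)
          ≈⟨ *-cong refl (trans (sum-*ʳ n _ _) (sum-cong n (λ j _ → summand k j))) ⟩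
        ι (invFact n) * Σ n (λ j → T j k)
          ∎

    rhs≈doubleSum : thm10RHS R ι m n lam p ≈ doubleSum
    rhs≈doubleSum = *-cong refl (sum-cong n (λ j _ → jth-term j))
      where
      jth-term : ∀ j → weight j * ι (bernoulliPoly m (ℕtoℚ j))
                       ≈ Σ m (λ k → weight j * (ιℕ j ^ k * bernoulliCoeff m k))
      jth-term j = trans (*-cong refl (bernoulliPoly-ascending m (ℕtoℚ j))) (sum-*ˡ m _ _)

mainTheorem10 : ∀ {c ℓ} (R : CommutativeRing c ℓ) (ι : ℚ → CommutativeRing.Carrier R) →
                  IsRingHomomorphism +-*-rawRing (CommutativeRing.rawRing R) ι →
                  (m n p : ℕ) (lam : CommutativeRing.Carrier R) →
                  CommutativeRing._≈_ R (thm10LHS R ι m n lam p) (thm10RHS R ι m n lam p)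
mainTheorem10 R ι ι-hom m n p lam =
  trans (lhs≈doubleSum m n p lam) (sym (rhs≈doubleSum m n p lam))
  where
  open CommutativeRing R using (trans; sym)
  open Theorem10 R ι ι-hom using (lhs≈doubleSum; rhs≈doubleSum)
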